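{- Let $\mathfrak{a}_0,\mathfrak{b}_0$ be applications with $\mathfrak{a}_0\overset{JT}{\sim}\mathfrak{b}_0$, let $1\le m<n$, and suppose there is $k$ with $m+1\le k\le n$ and $f^0_k\neq 0$, where $f^0_k$ is the probability $\mathfrak{a}_0$ assigns to $\alpha^k$. Then there exist two infinite sequences of applications $\mathfrak{a}_0,\mathfrak{a}_1,\dots$ and $\mathfrak{b}_0,\mathfrak{b}_1,\dots$ such that for all $i$, $\mathfrak{a}_{i+1}\overset{AT}{\underset{m}{\leadsto}}\mathfrak{a}_i$ and $\mathfrak{b}_{i+1}\overset{AT}{\underset{m}{\leadsto}}\mathfrak{b}_i$, and for all $i\neq 0$, it is not the case that $\mathfrak{a}_i\overset{ET}{\underset{m}{\sim}}\mathfrak{b}_i$.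
   Context: Fix an atomic target variable $a$ whose possible atomic values $\alpha^1,\dots,\alpha^n$ are exhaustive and pairwise mutually exclusive. An application $\mathfrak{a}$ of an ML system (a Training Set, a Learning Algorithm, a fixed input list of value attributions $\sigma$, and the target $a$) is identified with its output probability vector $(f_1,\dots,f_n)$, $f_i\in[0,1]$, $\sum_i f_i=1$, where $f_i$ is the probability assigned to $\alpha^i$; every such vector is the output of some application. For $\mathfrak{a}$ with $(f_i)$, $\mathfrak{b}$ with $(g_i)$ and $1\le m\le n$: $\mathfrak{a}\overset{JT}{\sim}\mathfrak{b}$ iff $f_i=g_i$ for all $i$; $\mathfrak{a}\overset{ET}{\underset{m}{\sim}}\mathfrak{b}$ iff $f_i=g_i$ for all $i\le m$; $\mathfrak{a}\overset{AT}{\underset{m}{\leadsto}}\mathfrak{b}$ iff $f_i\ge g_i$ for all $i\le m$.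
   Formalization: The probabilities $f_i$ of every application take values in the rationals, so also those of $\mathfrak{a}_0$, $\mathfrak{b}_0$ and of the two constructed sequences. -}

module Defs where

open import Data.Nat using (ℕ; zero; suc; _<_)
open import Data.Fin using (Fin; toℕ)
import Data.Fin as F
open import Data.Rational using (ℚ; 0ℚ; 1ℚ; _+_; _≤_)
open import Relation.Binary.PropositionalEquality using (_≡_)

sumℚ : ∀ {n} → (Fin n → ℚ) → ℚ
sumℚ {zero}  f = 0ℚ
sumℚ {suc n} f = f F.zero + sumℚ (λ i → f (F.suc i))

-- An application, identified with its output probability vector
-- (f_1,…,f_n); index i : Fin n stands for α^(toℕ i + 1).
record Application (n : ℕ) : Set where
  constructor app
  field
    prob    : Fin n → ℚ
    .nonneg : ∀ i → 0ℚ ≤ prob i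
    .le1    : ∀ i → prob i ≤ 1ℚ
    .total  : sumℚ prob ≡ 1ℚ
open Application public

_JT~_ : ∀ {n} → Application n → Application n → Set
a JT~ b = ∀ i → prob a i ≡ prob b i

ET~ : ∀ {n} → ℕ → Application n → Application n → Set
ET~ m a b = ∀ i → toℕ i < m → prob a i ≡ prob b i

AT⇝ : ∀ {n} → ℕ → Application n → Application n → Set
AT⇝ m a b = ∀ i → toℕ i < m → prob b i ≤ prob a i

{-# OPTIONS --safe #-}
module Submission where

-- Keep b₀ fixed, and from step 1 on replace a₀ by the vector obtained by
-- moving all the mass of an outcome α^k with k > m onto α^1.  This only
-- raises or keeps the first m probabilities, so both sequences are
-- AT-monotone; but α^1 gains f⁰_k ≠ 0 while b₀ still assigns it f⁰_1,
-- so ET fails at every step i ≥ 1.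

open import Defs
open import Data.Nat using (ℕ; zero; suc; _≤_; _<_; s≤s⁻¹)
open import Data.Nat.Properties using (<-irrefl; <-≤-trans)
open import Data.Fin using (Fin; toℕ)
import Data.Fin as F
open import Data.Vec.Functional using (_∷_; tail; updateAt)
open import Data.Vec.Functional.Properties using (updateAt-minimal)
open import Data.Rational using (ℚ; 0ℚ; 1ℚ; _+_) renaming (_≤_ to _≤ℚ_)
open import Data.Rational.Properties
  using (_≤?_; ≤-refl; ≤-reflexive; ≤-trans; +-mono-≤; +-monoʳ-≤; +-identityˡ; +-identityʳ;
         +-assoc; +-comm; +-0-group)
open import Algebra.Properties.Group +-0-group using (identityʳ-unique)
open import Data.Product using (Σ; ∃; _×_; _,_)
open import Function using (const)
open import Relation.Nullary using (¬_)
open import Relation.Nullary.Decidable using (recompute)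
open import Relation.Binary.PropositionalEquality
  using (_≡_; _≢_; refl; sym; trans; cong; subst; module ≡-Reasoning)

private
  variable
    n : ℕ

x≤x+nonneg : ∀ x {y} → 0ℚ ≤ℚ y → x ≤ℚ x + y
x≤x+nonneg x 0≤y = subst (_≤ℚ x + _) (+-identityʳ x) (+-monoʳ-≤ x 0≤y)

sumℚ-nonneg : (p : Fin n → ℚ) → (∀ i → 0ℚ ≤ℚ p i) → 0ℚ ≤ℚ sumℚ p
sumℚ-nonneg {zero}  p p≥0 = ≤-refl
sumℚ-nonneg {suc n} p p≥0 = subst (_≤ℚ sumℚ p) (+-identityˡ 0ℚ)
  (+-mono-≤ (p≥0 F.zero) (sumℚ-nonneg (tail p) (λ i → p≥0 (F.suc i))))

entry≤sumℚ : (p : Fin n → ℚ) → (∀ i → 0ℚ ≤ℚ p i) → ∀ i → p i ≤ℚ sumℚ p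
entry≤sumℚ p p≥0 F.zero    = x≤x+nonneg (p F.zero) (sumℚ-nonneg (tail p) (λ i → p≥0 (F.suc i)))
entry≤sumℚ p p≥0 (F.suc i) = ≤-trans
  (entry≤sumℚ (tail p) (λ j → p≥0 (F.suc j)) i)
  (subst (_≤ℚ sumℚ p) (+-identityˡ _) (+-mono-≤ (p≥0 F.zero) ≤-refl))

sumℚ-erase : (p : Fin n → ℚ) (k : Fin n) → sumℚ (updateAt p k (const 0ℚ)) + p k ≡ sumℚ p
sumℚ-erase p F.zero = begin
  (0ℚ + sumℚ (tail p)) + p F.zero ≡⟨ cong (_+ p F.zero) (+-identityˡ (sumℚ (tail p))) ⟩
  sumℚ (tail p) + p F.zero        ≡⟨ +-comm (sumℚ (tail p)) (p F.zero) ⟩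
  p F.zero + sumℚ (tail p)        ∎
  where open ≡-Reasoning
sumℚ-erase p (F.suc k) = begin
  (p F.zero + sumℚ (updateAt (tail p) k (const 0ℚ))) + p (F.suc k)
    ≡⟨ +-assoc (p F.zero) _ _ ⟩
  p F.zero + (sumℚ (updateAt (tail p) k (const 0ℚ)) + p (F.suc k))
    ≡⟨ cong (p F.zero +_) (sumℚ-erase (tail p) k) ⟩
  p F.zero + sumℚ (tail p) ∎
  where open ≡-Reasoning

updateAt-nonneg : (p : Fin n → ℚ) (k : Fin n) {h : ℚ → ℚ} → (∀ i → 0ℚ ≤ℚ p i) →
                  0ℚ ≤ℚ h (p k) → ∀ i → 0ℚ ≤ℚ updateAt p k h i
updateAt-nonneg p F.zero    p≥0 h≥0 F.zero    = h≥0
updateAt-nonneg p F.zero    p≥0 h≥0 (F.suc i) = p≥0 (F.suc i)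
updateAt-nonneg p (F.suc k) p≥0 h≥0 F.zero    = p≥0 F.zero
updateAt-nonneg p (F.suc k) p≥0 h≥0 (F.suc i) =
  updateAt-nonneg (tail p) k (λ j → p≥0 (F.suc j)) h≥0 i

probabilityVector : (p : Fin n → ℚ) → .(∀ i → 0ℚ ≤ℚ p i) → .(sumℚ p ≡ 1ℚ) → Application n
probabilityVector p p≥0 Σp≡1 =
  app p p≥0 (λ i → subst (p i ≤ℚ_) Σp≡1 (entry≤sumℚ p p≥0 i)) Σp≡1

prob-nonneg : (a : Application n) → ∀ i → 0ℚ ≤ℚ prob a i
prob-nonneg (app p p≥0 _ _) i = recompute (0ℚ ≤? p i) (p≥0 i)

moveToHead : Fin n → (Fin (suc n) → ℚ) → Fin (suc n) → ℚ
moveToHead k p = (p F.zero + p (F.suc k)) ∷ updateAt (tail p) k (const 0ℚ)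

moveToHead-nonneg : (k : Fin n) (p : Fin (suc n) → ℚ) → (∀ i → 0ℚ ≤ℚ p i) →
                    ∀ i → 0ℚ ≤ℚ moveToHead k p i
moveToHead-nonneg k p p≥0 F.zero    =
  ≤-trans (p≥0 F.zero) (x≤x+nonneg (p F.zero) (p≥0 (F.suc k)))
moveToHead-nonneg k p p≥0 (F.suc i) =
  updateAt-nonneg (tail p) k (λ j → p≥0 (F.suc j)) ≤-refl i

sumℚ-moveToHead : (k : Fin n) (p : Fin (suc n) → ℚ) → sumℚ (moveToHead k p) ≡ sumℚ p
sumℚ-moveToHead k p = begin
  (p F.zero + p (F.suc k)) + sumℚ erased ≡⟨ +-assoc (p F.zero) _ _ ⟩
  p F.zero + (p (F.suc k) + sumℚ erased) ≡⟨ cong (p F.zero +_) (+-comm (p (F.suc k)) _) ⟩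
  p F.zero + (sumℚ erased + p (F.suc k)) ≡⟨ cong (p F.zero +_) (sumℚ-erase (tail p) k) ⟩
  p F.zero + sumℚ (tail p)               ∎
  where
  open ≡-Reasoning
  erased = updateAt (tail p) k (const 0ℚ)

moveToHead-below : (k : Fin n) (p : Fin (suc n) → ℚ) (j : Fin n) → toℕ j < toℕ k →
                   moveToHead k p (F.suc j) ≡ p (F.suc j)
moveToHead-below k p j j<k = updateAt-minimal j k (tail p) j≢k
  where
  j≢k : j ≢ k
  j≢k refl = <-irrefl refl j<k

moveToHeadApp : Fin n → Application (suc n) → Application (suc n)
moveToHeadApp k (app p p≥0 _ Σp≡1) = probabilityVector (moveToHead k p)
  (moveToHead-nonneg k p p≥0) (trans (sumℚ-moveToHead k p) Σp≡1)

AT⇝-refl : ∀ m (a : Application n) → AT⇝ m a a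
AT⇝-refl m a i _ = ≤-refl

AT⇝-moveToHead : ∀ m (k : Fin n) (a : Application (suc n)) → m ≤ suc (toℕ k) →
                 AT⇝ m (moveToHeadApp k a) a
AT⇝-moveToHead m k a m≤k F.zero    _ = x≤x+nonneg (prob a F.zero) (prob-nonneg a (F.suc k))
AT⇝-moveToHead m k a m≤k (F.suc j) j<m =
  ≤-reflexive (sym (moveToHead-below k (prob a) j (s≤s⁻¹ (<-≤-trans j<m m≤k))))

mainTheorem3 : (n m : ℕ) (a₀ b₀ : Application n) → a₀ JT~ b₀ → 1 ≤ m → m < n →
    (∃ λ (k : Fin n) → m ≤ toℕ k × prob a₀ k ≢ 0ℚ) →
    Σ (ℕ → Application n) λ A → Σ (ℕ → Application n) λ B →
    A 0 ≡ a₀ × B 0 ≡ b₀ ×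
    (∀ i → AT⇝ m (A (suc i)) (A i)) ×
    (∀ i → AT⇝ m (B (suc i)) (B i)) ×
    (∀ i → ¬ ET~ m (A (suc i)) (B (suc i)))
mainTheorem3 (suc n) m a₀ b₀ a₀≡b₀ 1≤m _ (F.suc k , m≤k , fk≢0) =
  A , const b₀ , refl , refl , A-AT⇝ , (λ i → AT⇝-refl m b₀) , A≁B
  where
  A : ℕ → Application (suc n)
  A zero    = a₀
  A (suc _) = moveToHeadApp k a₀

  A-AT⇝ : ∀ i → AT⇝ m (A (suc i)) (A i)
  A-AT⇝ zero    = AT⇝-moveToHead m k a₀ m≤k
  A-AT⇝ (suc i) = AT⇝-refl m (A (suc i))

  A≁B : ∀ i → ¬ ET~ m (A (suc i)) b₀
  A≁B i et = fk≢0 (identityʳ-unique (prob a₀ F.zero) (prob a₀ (F.suc k))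
    (trans (et F.zero 1≤m) (sym (a₀≡b₀ F.zero))))
mainTheorem3 (suc n) (suc m) a₀ b₀ _ _ _ (F.zero , () , _)
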